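{- For every integer $a\ge 2$, $$ g(a,a+2,a+3,a+4)=\left(1+\left\lfloor \frac{a}{4}\right\rfloor\right)a+1. $$
   Context: For positive integers $a_1,\dots,a_m$ with $\gcd(a_1,\dots,a_m)=1$, the Frobenius number $g(a_1,\dots,a_m)$ is the largest positive integer that cannot be written as $x_1a_1+\cdots+x_ma_m$ with nonnegative integers $x_i$. $\lfloor x\rfloor$ is the floor. -}

module Defs where

open import Data.Nat using (ℕ; _+_; _*_; _<_)
open import Data.List using (List; []; _∷_)
open import Data.Product using (∃-syntax; _×_)
open import Relation.Nullary using (¬_)
open import Relation.Binary.PropositionalEquality using (_≡_)

data Representable : List ℕ → ℕ → Set where
  rep-nil  : Representable [] 0
  rep-cons : ∀ {a as n} (x : ℕ) → Representable as n → Representable (a ∷ as) (x * a + n)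

IsFrobeniusNumber : List ℕ → ℕ → Set
IsFrobeniusNumber as f = (0 < f) × ¬ Representable as f × (∀ m → f < m → Representable as m)

module Submission where

-- Splitting x₁a + x₂(a+2) + x₃(a+3) + x₄(a+4) as k a + s with k = x₁ + x₂ + x₃ + x₄,
-- the representable numbers are exactly the k a + s with 0 ≤ s ≤ 4k and s ≠ 1. For q = ⌊a/4⌋ the
-- blocks k a + [0, 4k] with k ≤ q stay at most (q+1) a, so (q+1) a + 1 is missed: in block q+1 it
-- would need s = 1, and block q+2 starts beyond it. Every larger m = k a + s (0 ≤ s < a) has k > q,
-- so s < a < 4(q+1) ≤ 4k; if s = 1 then k ≥ q+2 and m = (k-1) a + (a+1) is representable instead.

open import Defs
open import Data.Nat
  using (ℕ; zero; suc; _+_; _*_; _/_; _%_; _≤_; _<_; _≟_; NonZero; >-nonZero; s≤s; z≤n; z<s)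
open import Data.List using ([]; _∷_)
open import Data.Nat.Properties
open import Data.Nat.DivMod using (m≡m%n+[m/n]*n; m%n<n; m/n*n≤m)
open import Data.Nat.Tactic.RingSolver using (solve-∀)
open import Data.List.Membership.Propositional using (_∈_)
open import Data.List.Relation.Unary.Any using (here; there)
open import Data.Product using (∃₂; _×_; _,_)
open import Data.Sum using (inj₁; inj₂)
open import Relation.Binary using (tri<; tri≈; tri>)
open import Relation.Nullary using (¬_; yes; no; contradiction)
open import Relation.Binary.PropositionalEquality

representable-0 : ∀ as → Representable as 0
representable-0 []       = rep-nil
representable-0 (_ ∷ as) = rep-cons 0 (representable-0 as)

representable-∈ : ∀ {as a} → a ∈ as → Representable as a
representable-∈ {a ∷ as} (here refl) =
  subst (Representable _) (trans (+-identityʳ (1 * a)) (*-identityˡ a))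
        (rep-cons 1 (representable-0 as))
representable-∈ (there a∈as) = rep-cons 0 (representable-∈ a∈as)

representable-+ : ∀ {as m n} → Representable as m → Representable as n → Representable as (m + n)
representable-+ rep-nil r = r
representable-+ {a ∷ _} (rep-cons {n = m} x r) (rep-cons {n = n} y r′) =
  subst (Representable _) (regroup x y a m n) (rep-cons (x + y) (representable-+ r r′))
  where
  regroup : ∀ x y a m n → (x + y) * a + (m + n) ≡ (x * a + m) + (y * a + n)
  regroup = solve-∀

k*a+s≤[1+q]*a : ∀ {a k q s} → k ≤ q → s ≤ a → k * a + s ≤ suc q * a
k*a+s≤[1+q]*a {a} {k} {q} {s} k≤q s≤a =
  subst (k * a + s ≤_) (+-comm (q * a) a) (+-mono-≤ (*-monoˡ-≤ a k≤q) s≤a)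

[1+q]*a+1<k*a+s : ∀ {a k q} s → 2 ≤ a → suc q < k → suc q * a + 1 < k * a + s
[1+q]*a+1<k*a+s {a} {k} {q} s 2≤a 1+q<k = begin-strict
  suc q * a + 1      <⟨ +-monoʳ-< (suc q * a) 2≤a ⟩
  suc q * a + a      ≡⟨ +-comm (suc q * a) a ⟩
  suc (suc q) * a    ≤⟨ *-monoˡ-≤ a 1+q<k ⟩
  k * a              ≤⟨ m≤m+n (k * a) s ⟩
  k * a + s          ∎
  where open ≤-Reasoning

offset≢[1+q]*a+1 : ∀ {a q k s} → 2 ≤ a → 4 * q ≤ a → s ≤ 4 * k → s ≢ 1 →
                   k * a + s ≢ suc q * a + 1
offset≢[1+q]*a+1 {a} {q} {k} {s} 2≤a 4q≤a s≤4k s≢1 eq with <-cmp k (suc q)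
... | tri< (s≤s k≤q) _ _ = <⇒≢ (≤-<-trans (k*a+s≤[1+q]*a k≤q s≤a) (m<m+n _ z<s)) eq
  where
  s≤a : s ≤ a
  s≤a = ≤-trans s≤4k (≤-trans (*-monoʳ-≤ 4 k≤q) 4q≤a)
... | tri≈ _ refl _ = s≢1 (+-cancelˡ-≡ (suc q * a) s 1 eq)
... | tri> _ _ 1+q<k = >⇒≢ ([1+q]*a+1<k*a+s s 2≤a 1+q<k) eq

module _ (a : ℕ) where

  private
    R : ℕ → Set
    R = Representable (a ∷ a + 2 ∷ a + 3 ∷ a + 4 ∷ [])

  multiple-representable : ∀ k → R (k * a)
  multiple-representable zero    = representable-0 _
  multiple-representable (suc k) = representable-+ (representable-∈ (here refl)) (multiple-representable k)

  representable-step : ∀ {g} → a + g ∈ (a ∷ a + 2 ∷ a + 3 ∷ a + 4 ∷ []) →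
                       ∀ k s → R (k * a + s) → R (suc k * a + (g + s))
  representable-step {g} a+g∈ k s r =
    subst R (regroup a g k s) (representable-+ (representable-∈ a+g∈) r)
    where
    regroup : ∀ a g k s → (a + g) + (k * a + s) ≡ suc k * a + (g + s)
    regroup = solve-∀

  offset-representable : ∀ k s → s ≤ 4 * k → s ≢ 1 → R (k * a + s)
  offset-representable k 0 _ _ = subst R (sym (+-identityʳ (k * a))) (multiple-representable k)
  offset-representable k 1 _ s≢1 = contradiction refl s≢1
  offset-representable zero (suc _) () _
  offset-representable (suc k) 2 _ _ =
    representable-step (there (here refl)) k 0 (offset-representable k 0 z≤n λ ())
  offset-representable (suc k) 3 _ _ =
    representable-step (there (there (here refl))) k 0 (offset-representable k 0 z≤n λ ())
  offset-representable (suc k) 4 _ _ =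
    representable-step (there (there (there (here refl)))) k 0 (offset-representable k 0 z≤n λ ())
  offset-representable (suc zero) 5 (s≤s (s≤s (s≤s (s≤s ())))) _
  offset-representable (suc (suc k)) 5 _ _ =
    representable-step (there (here refl)) (suc k) 3
      (offset-representable (suc k) 3 (≤-trans (n≤1+n 3) (*-monoʳ-≤ 4 (s≤s z≤n))) λ ())
  offset-representable (suc k) (suc (suc (suc (suc (suc (suc s)))))) 6+s≤4[1+k] _ =
    representable-step (there (there (there (here refl)))) k (2 + s)
      (offset-representable k (2 + s) 2+s≤4k λ ())
    where
    2+s≤4k : 2 + s ≤ 4 * k
    2+s≤4k = +-cancelˡ-≤ 4 (2 + s) (4 * k) (subst (6 + s ≤_) (*-suc 4 k) 6+s≤4[1+k])

  representable⇒offset : ∀ {n} → R n → ∃₂ λ k s → s ≤ 4 * k × s ≢ 1 × n ≡ k * a + s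
  representable⇒offset (rep-cons x₁ (rep-cons x₂ (rep-cons x₃ (rep-cons x₄ rep-nil)))) =
    x₁ + x₂ + x₃ + x₄ , x₂ * 2 + x₃ * 3 + x₄ * 4 ,
    subst (x₂ * 2 + x₃ * 3 + x₄ * 4 ≤_) (slack x₁ x₂ x₃ x₄) (m≤m+n _ _) ,
    2x₂+3x₃+4x₄≢1 x₂ x₃ x₄ ,
    regroup a x₁ x₂ x₃ x₄
    where
    slack : ∀ x₁ x₂ x₃ x₄ → (x₂ * 2 + x₃ * 3 + x₄ * 4) + (x₁ * 4 + x₂ * 2 + x₃)
                            ≡ 4 * (x₁ + x₂ + x₃ + x₄)
    slack = solve-∀
    regroup : ∀ a x₁ x₂ x₃ x₄ →
              x₁ * a + (x₂ * (a + 2) + (x₃ * (a + 3) + (x₄ * (a + 4) + 0)))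
              ≡ (x₁ + x₂ + x₃ + x₄) * a + (x₂ * 2 + x₃ * 3 + x₄ * 4)
    regroup = solve-∀
    2x₂+3x₃+4x₄≢1 : ∀ x₂ x₃ x₄ → x₂ * 2 + x₃ * 3 + x₄ * 4 ≢ 1
    2x₂+3x₃+4x₄≢1 zero    zero    zero    ()
    2x₂+3x₃+4x₄≢1 zero    zero    (suc _) ()
    2x₂+3x₃+4x₄≢1 zero    (suc _) _       ()
    2x₂+3x₃+4x₄≢1 (suc _) _       _       ()

  representable-past-block : ∀ {q} k s → a < 4 * suc q → q < k → s < a →
                             k * a + s ≢ suc q * a + 1 → R (k * a + s)
  representable-past-block k s a<4[1+q] q<k s<a ≢f with s ≟ 1
  ... | no s≢1 =
    offset-representable k s (≤-trans (<⇒≤ (<-trans s<a a<4[1+q])) (*-monoʳ-≤ 4 q<k)) s≢1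
  ... | yes refl with m≤n⇒m<n∨m≡n q<k
  ...   | inj₂ refl = contradiction refl ≢f
  ...   | inj₁ (s≤s {n = k′} q<k′) =
    subst R (regroup a k′)
      (offset-representable k′ (suc a) (≤-trans a<4[1+q] (*-monoʳ-≤ 4 q<k′)) 1+a≢1)
    where
    regroup : ∀ a k → k * a + suc a ≡ suc k * a + 1
    regroup = solve-∀
    1+a≢1 : suc a ≢ 1
    1+a≢1 1+a≡1 = <⇒≢ (<-trans z<s s<a) (sym (suc-injective 1+a≡1))

  representable-beyond : ∀ {q} .{{_ : NonZero a}} → a < 4 * suc q →
                         ∀ m → suc q * a + 1 < m → R m
  representable-beyond {q} a<4[1+q] m f<m =
    subst R (sym m≡k*a+s)
      (representable-past-block k s a<4[1+q] q<k (m%n<n m a) (>⇒≢ (subst (_ <_) m≡k*a+s f<m)))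
    where
    k = m / a
    s = m % a
    m≡k*a+s : m ≡ k * a + s
    m≡k*a+s = trans (m≡m%n+[m/n]*n m a) (+-comm s (k * a))
    q<k : q < k
    q<k = ≰⇒> λ k≤q → <-irrefl refl (begin-strict
      m              ≡⟨ m≡k*a+s ⟩
      k * a + s      ≤⟨ k*a+s≤[1+q]*a k≤q (<⇒≤ (m%n<n m a)) ⟩
      suc q * a      <⟨ m<m+n _ z<s ⟩
      suc q * a + 1  <⟨ f<m ⟩
      m              ∎)
      where open ≤-Reasoning

a<4*[1+a/4] : ∀ a → a < 4 * suc (a / 4)
a<4*[1+a/4] a = begin-strict
  a                    ≡⟨ m≡m%n+[m/n]*n a 4 ⟩
  a % 4 + a / 4 * 4    <⟨ +-monoˡ-< (a / 4 * 4) (m%n<n a 4) ⟩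
  suc (a / 4) * 4      ≡⟨ *-comm (suc (a / 4)) 4 ⟩
  4 * suc (a / 4)      ∎
  where open ≤-Reasoning

corollary2 : ∀ (a : ℕ) → 2 ≤ a →
    IsFrobeniusNumber (a ∷ (a + 2) ∷ (a + 3) ∷ (a + 4) ∷ []) ((1 + a / 4) * a + 1)
corollary2 a 2≤a = m≤n+m 1 _ , not-representable , representable-beyond a {{nonZero}} (a<4*[1+a/4] a)
  where
  nonZero : NonZero a
  nonZero = >-nonZero (<-trans z<s 2≤a)
  4[a/4]≤a : 4 * (a / 4) ≤ a
  4[a/4]≤a = subst (_≤ a) (*-comm (a / 4) 4) (m/n*n≤m a 4)
  not-representable : ¬ Representable (a ∷ a + 2 ∷ a + 3 ∷ a + 4 ∷ []) ((1 + a / 4) * a + 1)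
  not-representable r with representable⇒offset a r
  ... | k , _ , s≤4k , s≢1 , f≡k*a+s =
    offset≢[1+q]*a+1 {q = a / 4} {k} 2≤a 4[a/4]≤a s≤4k s≢1 (sym f≡k*a+s)
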